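{- Let $(a_i)_{i\ge0}$ be given by $a_0=1$ and $a_i=|w_i|$ for $i\ge1$, where $w_1=01$ and $w_i=w_{i-1}^2\big(\prod_{j=1}^{i-2}w_{i-1-j}\big)2$ for $i\ge2$ (so $(a_i)=(1,2,5,13,34,\dots)$). A finite string over $\{0,1,2\}$ (read from most significant to least significant digit, leading zeros ignored) is the $(a_i)$-representation of some nonnegative integer if and only if every $2$ in the string is followed immediately by some number (zero or more) of consecutive $1$'s and then a $0$.
   Context: Products denote concatenation of words. For $n\ge1$ with $a_j\le n<a_{j+1}$, the $(a_i)$-representation of $n$ is the digit string $d_j\cdots d_0$ with $n=\sum d_ia_i$ and $\sum d_i$ minimal (greedy); the representation of $0$ is $0$. -}

module Defs where

open import Data.Nat using (ℕ; zero; suc; _≤?_; NonZero)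
open import Data.Nat.DivMod using (_/_; _%_)
open import Data.Fin using (Fin; toℕ)
open import Data.List using (List; []; _∷_; _++_; concat; length; map; replicate)
open import Data.Product using (Σ; ∃; _×_; _,_)
open import Relation.Binary.PropositionalEquality using (_≡_; refl; cong)
open import Relation.Nullary using (yes; no)

-- The words w_i, i ≥ 1, over the alphabet {0,1,2} (letters as ℕ).
-- ws n = [w_n, w_{n-1}, ..., w_1]  (ws 0 = []).
step : List (List ℕ) → List (List ℕ)
step []         = []
step (u ∷ rest) = (u ++ u ++ concat rest ++ (2 ∷ [])) ∷ u ∷ rest

ws : ℕ → List (List ℕ)
ws zero                = []
ws (suc zero)          = (0 ∷ 1 ∷ []) ∷ []
ws (suc (suc k))       = step (ws (suc k))

headOr : List (List ℕ) → List ℕ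
headOr []      = []
headOr (u ∷ _) = u

-- w i = w_i for i ≥ 1  (w 0 is unused)
w : ℕ → List ℕ
w i = headOr (ws i)

a : ℕ → ℕ
a zero    = 1
a (suc k) = length (w (suc k))

-- every w_i (i ≥ 1) starts with the letter 0, hence a_i ≠ 0
ws-shape : ∀ k → Σ (List ℕ) λ u → Σ (List (List ℕ)) λ rest → ws (suc k) ≡ (0 ∷ u) ∷ rest
ws-shape zero    = 1 ∷ [] , [] , refl
ws-shape (suc k) with ws (suc k) | ws-shape k
... | .((0 ∷ u) ∷ rest) | u , rest , refl =
  u ++ (0 ∷ u) ++ concat rest ++ (2 ∷ []) , (0 ∷ u) ∷ rest , refl

a-suc : ∀ i → Σ ℕ λ m → a i ≡ suc m
a-suc zero = 0 , refl
a-suc (suc k) with ws (suc k) | ws-shape k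
... | .((0 ∷ u) ∷ rest) | u , rest , refl = length u , refl

a-nonZero : ∀ i → NonZero (a i)
a-nonZero i with a i | a-suc i
... | .(suc m) | m , refl = _

topAux : ℕ → ℕ → ℕ
topAux n zero    = zero
topAux n (suc j) with a (suc j) ≤? n
... | yes _ = suc j
... | no  _ = topAux n j

-- the j with a_j ≤ n < a_{j+1}  (for n ≥ 1; since a_j > j, j ≤ n)
top : ℕ → ℕ
top n = topAux n n

greedy : ℕ → ℕ → List ℕ
greedy zero    r = (_/_ r (a zero) {{a-nonZero zero}}) ∷ []
greedy (suc i) r = (_/_ r (a (suc i)) {{a-nonZero (suc i)}}) ∷ greedy i (_%_ r (a (suc i)) {{a-nonZero (suc i)}})

rep : ℕ → List ℕ
rep zero        = 0 ∷ []
rep n@(suc _)   = greedy (top n) n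

dropZeros : List ℕ → List ℕ
dropZeros []            = []
dropZeros (zero ∷ xs)   = dropZeros xs
dropZeros (suc x ∷ xs)  = suc x ∷ xs

IsRepresentation : List (Fin 3) → Set
IsRepresentation s = ∃ λ n → dropZeros (map toℕ s) ≡ dropZeros (rep n)

TwoCondition : List (Fin 3) → Set
TwoCondition s = ∀ (xs ys : List (Fin 3)) → s ≡ xs ++ (Data.Fin.fromℕ< {2} {3} (Data.Nat.s≤s (Data.Nat.s≤s (Data.Nat.s≤s Data.Nat.z≤n)))) ∷ ys →
  ∃ λ k → ∃ λ zs → ys ≡ replicate k (Data.Fin.suc Data.Fin.zero) ++ Data.Fin.zero ∷ zs

-- Write Σa m = a_0 + ⋯ + a_{m-1}.  Counting letters in w_{m+1} = w_m w_m w_{m-1} ⋯ w_1 2 gives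
-- a_{m+1} = 2 a_m + Σa m, and Σa m ≤ a_m.  Call a digit string admissible if every 2 in it is
-- followed by 1^k 0.  By induction, an admissible string of length L has value below a_L, and one
-- that moreover starts with 1^k 0 has value below Σa L; so division by a_{L-1} reads off its leading
-- digit and greedy expansion recovers every admissible string from its value.  Conversely, the
-- greedy expansion of r < a_{i+1} is admissible: its leading digit r / a_i is at most 2, and after a
-- leading 2 the remainder is below Σa (i+1), which forces the following digits to be 1^k 0.
module Submission where

open import Defs
open import Data.Fin using (Fin)
open import Data.List using (List)
open import Function.Bundles using (_⇔_)

open import Data.Nat using (ℕ; zero; suc; _+_; _*_; _≤_; _<_; z≤n; s≤s; NonZero; >-nonZero⁻¹; s≤s⁻¹; _≤?_)
open import Data.Nat.Properties
open import Data.Nat.DivMod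
open import Data.Nat.Divisibility using (n∣m*n)
open import Data.Fin using (toℕ)
open import Data.Fin.Patterns using (0F; 1F; 2F)
open import Data.List using ([]; _∷_; _++_; concat; length; map; replicate)
open import Data.List.Properties using (length-++)
open import Data.Product using (∃; _,_)
open import Data.Sum using (inj₁; inj₂)
open import Relation.Binary.PropositionalEquality
open import Relation.Nullary using (yes; no)
open import Function.Bundles using (mk⇔)

Σa : ℕ → ℕ
Σa zero    = 0
Σa (suc m) = a m + Σa m

ws-suc : ∀ k → ws (suc k) ≡ w (suc k) ∷ ws k
ws-suc zero    = refl
ws-suc (suc k) = step-cons (ws-suc k)
  where
  step-cons : ∀ {l u r} → l ≡ u ∷ r → step l ≡ headOr (step l) ∷ l
  step-cons refl = refl

-- The extra 1 is a_0, which has no word w_0.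
suc-length-concat-ws : ∀ k → suc (length (concat (ws k))) ≡ Σa (suc k)
suc-length-concat-ws zero    = refl
suc-length-concat-ws (suc k) = begin
  suc (length (concat (ws (suc k))))         ≡⟨ cong (λ l → suc (length (concat l))) (ws-suc k) ⟩
  suc (length (w (suc k) ++ concat (ws k)))  ≡⟨ cong suc (length-++ (w (suc k))) ⟩
  suc (a (suc k) + length (concat (ws k)))   ≡⟨ +-suc (a (suc k)) _ ⟨
  a (suc k) + suc (length (concat (ws k)))   ≡⟨ cong (a (suc k) +_) (suc-length-concat-ws k) ⟩
  Σa (suc (suc k))                           ∎
  where open ≡-Reasoning

a-recurrence : ∀ m → a (suc m) ≡ 2 * a m + Σa m
a-recurrence zero    = refl
a-recurrence (suc k) = begin
  length (headOr (step (ws (suc k))))                   ≡⟨ cong (λ l → length (headOr (step l))) (ws-suc k) ⟩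
  length (u ++ u ++ concat (ws k) ++ 2 ∷ [])            ≡⟨ length-++ u ⟩
  length u + length (u ++ concat (ws k) ++ 2 ∷ [])      ≡⟨ cong (length u +_) (length-++ u) ⟩
  A + (A + length (concat (ws k) ++ 2 ∷ []))            ≡⟨ cong (λ z → A + (A + z)) (length-++ (concat (ws k))) ⟩
  A + (A + (length (concat (ws k)) + 1))                ≡⟨ cong (λ z → A + (A + z)) (+-comm _ 1) ⟩
  A + (A + suc (length (concat (ws k))))                ≡⟨ cong (λ z → A + (A + z)) (suc-length-concat-ws k) ⟩
  A + (A + Σa (suc k))                                  ≡⟨ +-assoc A A _ ⟨
  A + A + Σa (suc k)                                    ≡⟨ cong (λ z → A + z + Σa (suc k)) (+-identityʳ A) ⟨
  2 * A + Σa (suc k)                                    ∎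
  where
  open ≡-Reasoning
  u = w (suc k)
  A = a (suc k)

Σa≤a : ∀ m → Σa m ≤ a m
Σa≤a zero    = z≤n
Σa≤a (suc m) = begin
  a m + Σa m     ≤⟨ +-monoˡ-≤ (Σa m) (m≤m+n (a m) (a m + 0)) ⟩
  2 * a m + Σa m ≡⟨ a-recurrence m ⟨
  a (suc m)      ∎
  where open ≤-Reasoning

a<a-suc : ∀ m → a m < a (suc m)
a<a-suc m = begin-strict
  a m            <⟨ m<m+n (a m) (<-≤-trans (>-nonZero⁻¹ (a m) {{a-nonZero m}}) (m≤m+n (a m) 0)) ⟩
  2 * a m        ≤⟨ m≤m+n (2 * a m) (Σa m) ⟩
  2 * a m + Σa m ≡⟨ a-recurrence m ⟨
  a (suc m)      ∎
  where open ≤-Reasoning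

a-mono-≤ : ∀ {i k} → i ≤ k → a i ≤ a k
a-mono-≤ {k = zero}  z≤n = ≤-refl
a-mono-≤ {k = suc k} i≤1+k with m≤n⇒m<n∨m≡n i≤1+k
... | inj₂ refl      = ≤-refl
... | inj₁ (s≤s i≤k) = ≤-trans (a-mono-≤ i≤k) (<⇒≤ (a<a-suc k))

n<a : ∀ n → n < a n
n<a zero    = s≤s z≤n
n<a (suc n) = <-≤-trans (s≤s (n<a n)) (a<a-suc n)

n<a[1+top[n]] : ∀ n → n < a (suc (top n))
n<a[1+top[n]] n = topAux-bound n n (<-trans (n<a n) (a<a-suc n))
  where
  topAux-bound : ∀ n b → n < a (suc b) → n < a (suc (topAux n b))
  topAux-bound n zero    n<a = n<a
  topAux-bound n (suc j) n<a with a (suc j) ≤? n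
  ... | yes _ = n<a
  ... | no  p = topAux-bound n j (≰⇒> p)

[m*n+o]/n≡m : ∀ m {n o} .{{_ : NonZero n}} → o < n → (m * n + o) / n ≡ m
[m*n+o]/n≡m m {n} {o} o<n = begin
  (m * n + o) / n    ≡⟨ +-distrib-/-∣ˡ o (n∣m*n m) ⟩
  m * n / n + o / n  ≡⟨ cong₂ _+_ (m*n/n≡m m n) (m<n⇒m/n≡0 o<n) ⟩
  m + 0              ≡⟨ +-identityʳ m ⟩
  m                  ∎
  where open ≡-Reasoning

[m*n+o]%n≡o : ∀ m {n o} .{{_ : NonZero n}} → o < n → (m * n + o) % n ≡ o
[m*n+o]%n≡o m {n} {o} o<n = trans (%-remove-+ˡ o (n∣m*n m)) (m<n⇒m%n≡m o<n)

m<d*n+p⇒m/n≤d : ∀ {m n p} d .{{_ : NonZero n}} → p ≤ n → m < d * n + p → m / n ≤ d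
m<d*n+p⇒m/n≤d {m} {n} {p} d p≤n m<d*n+p = s≤s⁻¹ (m<n*o⇒m/o<n (begin-strict
  m          <⟨ m<d*n+p ⟩
  d * n + p  ≤⟨ +-monoʳ-≤ (d * n) p≤n ⟩
  d * n + n  ≡⟨ +-comm (d * n) n ⟩
  suc d * n  ∎))
  where open ≤-Reasoning

m/n≡d⇒m%n<p : ∀ {m n p} d .{{_ : NonZero n}} → m / n ≡ d → m < d * n + p → m % n < p
m/n≡d⇒m%n<p {m} {n} {p} d m/n≡d m<d*n+p = +-cancelʳ-< (d * n) (m % n) p (begin-strict
  m % n + d * n      ≡⟨ cong (λ q → m % n + q * n) m/n≡d ⟨
  m % n + m / n * n  ≡⟨ m≡m%n+[m/n]*n m n ⟨
  m                  <⟨ m<d*n+p ⟩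
  d * n + p          ≡⟨ +-comm (d * n) p ⟩
  p + d * n          ∎)
  where open ≤-Reasoning

greedy-suc : ∀ i d {q} → q < a (suc i) → greedy (suc i) (d * a (suc i) + q) ≡ d ∷ greedy i q
greedy-suc i d q<a = cong₂ _∷_ ([m*n+o]/n≡m d {{a-nonZero (suc i)}} q<a)
                             (cong (greedy i) ([m*n+o]%n≡o d {{a-nonZero (suc i)}} q<a))

data OnesThenZero : List ℕ → Set where
  0∷_ : ∀ ds → OnesThenZero (0 ∷ ds)
  1∷_ : ∀ {ds} → OnesThenZero ds → OnesThenZero (1 ∷ ds)

data Admissible : List ℕ → Set where
  []  : Admissible []
  0∷_ : ∀ {ds} → Admissible ds → Admissible (0 ∷ ds)
  1∷_ : ∀ {ds} → Admissible ds → Admissible (1 ∷ ds)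
  2∷  : ∀ {ds} → OnesThenZero ds → Admissible ds → Admissible (2 ∷ ds)

admissible-tail : ∀ {d ds} → Admissible (d ∷ ds) → Admissible ds
admissible-tail (0∷ h)   = h
admissible-tail (1∷ h)   = h
admissible-tail (2∷ _ h) = h

onesThenZero-∷ : ∀ {d ds} → d ≤ 1 → (d ≡ 1 → OnesThenZero ds) → OnesThenZero (d ∷ ds)
onesThenZero-∷ {0} {ds} _ _    = 0∷ ds
onesThenZero-∷ {1}      _ tail = 1∷ tail refl
onesThenZero-∷ {suc (suc _)} (s≤s ())

admissible-∷ : ∀ {d ds} → d ≤ 2 → (d ≡ 2 → OnesThenZero ds) → Admissible ds → Admissible (d ∷ ds)
admissible-∷ {0} _ _ h = 0∷ h
admissible-∷ {1} _ _ h = 1∷ h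
admissible-∷ {2} _ o h = 2∷ (o refl) h
admissible-∷ {suc (suc (suc _))} (s≤s (s≤s ()))

value : List ℕ → ℕ
value []       = 0
value (d ∷ ds) = d * a (length ds) + value ds

mutual
  value<a : ∀ {ds} → Admissible ds → value ds < a (length ds)
  value<a []              = s≤s z≤n
  value<a {0 ∷ ds} (0∷ h) = <-trans (value<a h) (a<a-suc (length ds))
  value<a {1 ∷ ds} (1∷ h) = begin-strict
    1 * A + value ds       <⟨ +-monoʳ-< (1 * A) (value<a h) ⟩
    1 * A + A              ≡⟨ +-comm (1 * A) A ⟩
    2 * A                  ≤⟨ m≤m+n (2 * A) (Σa (length ds)) ⟩
    2 * A + Σa (length ds) ≡⟨ a-recurrence (length ds) ⟨
    a (suc (length ds))    ∎
    where
    open ≤-Reasoning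
    A = a (length ds)
  value<a {2 ∷ ds} (2∷ o h) = begin-strict
    2 * A + value ds       <⟨ +-monoʳ-< (2 * A) (value<Σa h o) ⟩
    2 * A + Σa (length ds) ≡⟨ a-recurrence (length ds) ⟨
    a (suc (length ds))    ∎
    where
    open ≤-Reasoning
    A = a (length ds)

  value<Σa : ∀ {ds} → Admissible ds → OnesThenZero ds → value ds < Σa (length ds)
  value<Σa {0 ∷ ds} (0∷ h) (0∷ _) = <-≤-trans (value<a h) (m≤m+n _ _)
  value<Σa {1 ∷ ds} (1∷ h) (1∷ o) = begin-strict
    1 * A + value ds       <⟨ +-monoʳ-< (1 * A) (value<Σa h o) ⟩
    1 * A + Σa (length ds) ≡⟨ cong (_+ Σa (length ds)) (*-identityˡ A) ⟩
    Σa (suc (length ds))   ∎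
    where
    open ≤-Reasoning
    A = a (length ds)

greedy-value : ∀ d ds → Admissible (d ∷ ds) → greedy (length ds) (value (d ∷ ds)) ≡ d ∷ ds
greedy-value d []       _ = cong (_∷ []) ([m*n+o]/n≡m d (s≤s z≤n))
greedy-value d (e ∷ ds) h = begin
  greedy (suc (length ds)) (d * a (suc (length ds)) + value (e ∷ ds))
    ≡⟨ greedy-suc (length ds) d (value<a (admissible-tail h)) ⟩
  d ∷ greedy (length ds) (value (e ∷ ds))
    ≡⟨ cong (d ∷_) (greedy-value e ds (admissible-tail h)) ⟩
  d ∷ e ∷ ds ∎
  where open ≡-Reasoning

greedy-onesThenZero : ∀ i r → r < Σa (suc i) → OnesThenZero (greedy i r)
greedy-onesThenZero zero    zero    _          = 0∷ []
greedy-onesThenZero zero    (suc _) (s≤s ())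
greedy-onesThenZero (suc i) r       r<Σa = onesThenZero-∷
  (m<d*n+p⇒m/n≤d 1 {{a-nonZero (suc i)}} (Σa≤a (suc i)) r<A+Σa)
  (λ r/A≡1 → greedy-onesThenZero i _ (m/n≡d⇒m%n<p 1 {{a-nonZero (suc i)}} r/A≡1 r<A+Σa))
  where
  r<A+Σa : r < 1 * a (suc i) + Σa (suc i)
  r<A+Σa = subst (λ A → r < A + Σa (suc i)) (sym (*-identityˡ (a (suc i)))) r<Σa

greedy-admissible : ∀ i r → r < a (suc i) → Admissible (greedy i r)
greedy-admissible zero    0 _ = 0∷ []
greedy-admissible zero    1 _ = 1∷ []
greedy-admissible zero    (suc (suc _)) (s≤s (s≤s ()))
greedy-admissible (suc i) r r<a = admissible-∷
  (m<d*n+p⇒m/n≤d 2 {{a-nonZero (suc i)}} (Σa≤a (suc i)) r<2A+Σa)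
  (λ r/A≡2 → greedy-onesThenZero i _ (m/n≡d⇒m%n<p 2 {{a-nonZero (suc i)}} r/A≡2 r<2A+Σa))
  (greedy-admissible i _ (m%n<n r (a (suc i)) {{a-nonZero (suc i)}}))
  where
  r<2A+Σa : r < 2 * a (suc i) + Σa (suc i)
  r<2A+Σa = subst (r <_) (a-recurrence (suc i)) r<a

dropZeros-greedy-≤ : ∀ {n i} k → i ≤ k → n < a (suc i) → dropZeros (greedy k n) ≡ dropZeros (greedy i n)
dropZeros-greedy-≤ zero z≤n _ = refl
dropZeros-greedy-≤ {n} {i} (suc k) i≤1+k n<a with m≤n⇒m<n∨m≡n i≤1+k
... | inj₂ refl      = refl
... | inj₁ (s≤s i≤k) = begin
  dropZeros (greedy (suc k) n)  ≡⟨ cong dropZeros (greedy-suc k 0 (<-≤-trans n<a (a-mono-≤ (s≤s i≤k)))) ⟩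
  dropZeros (greedy k n)        ≡⟨ dropZeros-greedy-≤ k i≤k n<a ⟩
  dropZeros (greedy i n)        ∎
  where open ≡-Reasoning

dropZeros-rep : ∀ n i → n < a (suc i) → dropZeros (rep n) ≡ dropZeros (greedy i n)
dropZeros-rep zero      i _   = sym (dropZeros-greedy-≤ i z≤n (s≤s z≤n))
dropZeros-rep n@(suc _) i n<a with ≤-total (top n) i
... | inj₁ top≤i = sym (dropZeros-greedy-≤ i top≤i (n<a[1+top[n]] n))
... | inj₂ i≤top = dropZeros-greedy-≤ (top n) i≤top n<a

rep-admissible : ∀ n → Admissible (rep n)
rep-admissible zero       = 0∷ []
rep-admissible n@(suc _) = greedy-admissible (top n) n (n<a[1+top[n]] n)

admissible⇒representation : ∀ ds → Admissible ds → ∃ λ n → dropZeros ds ≡ dropZeros (rep n)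
admissible⇒representation []       _ = 0 , refl
admissible⇒representation (d ∷ ds) h = value (d ∷ ds) , (begin
  dropZeros (d ∷ ds)                               ≡⟨ cong dropZeros (greedy-value d ds h) ⟨
  dropZeros (greedy (length ds) (value (d ∷ ds)))  ≡⟨ dropZeros-rep _ (length ds) (value<a h) ⟨
  dropZeros (rep (value (d ∷ ds)))                 ∎)
  where open ≡-Reasoning

dropZeros⁺ : ∀ {ds} → Admissible ds → Admissible (dropZeros ds)
dropZeros⁺ []       = []
dropZeros⁺ (0∷ h)   = dropZeros⁺ h
dropZeros⁺ (1∷ h)   = 1∷ h
dropZeros⁺ (2∷ o h) = 2∷ o h

dropZeros⁻ : ∀ ds → Admissible (dropZeros ds) → Admissible ds
dropZeros⁻ []          h = h
dropZeros⁻ (zero ∷ ds) h = 0∷ dropZeros⁻ ds h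
dropZeros⁻ (suc _ ∷ _) h = h

representation⇒admissible : ∀ ds → (∃ λ n → dropZeros ds ≡ dropZeros (rep n)) → Admissible ds
representation⇒admissible ds (n , eq) = dropZeros⁻ ds (subst Admissible (sym eq) (dropZeros⁺ (rep-admissible n)))

onesThenZero-replicate : ∀ k (zs : List (Fin 3)) → OnesThenZero (map toℕ (replicate k 1F ++ 0F ∷ zs))
onesThenZero-replicate zero    zs = 0∷ map toℕ zs
onesThenZero-replicate (suc k) zs = 1∷ onesThenZero-replicate k zs

onesThenZero⇒replicate : ∀ (ys : List (Fin 3)) → OnesThenZero (map toℕ ys) → ∃ λ k → ∃ λ zs → ys ≡ replicate k 1F ++ 0F ∷ zs
onesThenZero⇒replicate (0F ∷ zs) (0∷ _) = 0 , zs , refl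
onesThenZero⇒replicate (1F ∷ ys) (1∷ o) with onesThenZero⇒replicate ys o
... | k , zs , refl = suc k , zs , refl

twoCondition⇒admissible : ∀ s → TwoCondition s → Admissible (map toℕ s)
twoCondition⇒admissible []      _ = []
twoCondition⇒admissible (x ∷ s) h with twoCondition⇒admissible s (λ xs ys eq → h (x ∷ xs) ys (cong (x ∷_) eq))
twoCondition⇒admissible (0F ∷ s) h | t = 0∷ t
twoCondition⇒admissible (1F ∷ s) h | t = 1∷ t
twoCondition⇒admissible (2F ∷ s) h | t with h [] s refl
... | k , zs , refl = 2∷ (onesThenZero-replicate k zs) t

admissible⇒twoCondition : ∀ s → Admissible (map toℕ s) → TwoCondition s
admissible⇒twoCondition .(2F ∷ ys)           (2∷ o _) []       ys refl = onesThenZero⇒replicate ys o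
admissible⇒twoCondition .(x ∷ xs ++ 2F ∷ ys) h        (x ∷ xs) ys refl =
  admissible⇒twoCondition (xs ++ 2F ∷ ys) (admissible-tail h) xs ys refl

proposition5p13 : (s : List (Fin 3)) → IsRepresentation s ⇔ TwoCondition s
proposition5p13 s = mk⇔
  (λ isRep → admissible⇒twoCondition s (representation⇒admissible (map toℕ s) isRep))
  (λ twoCond → admissible⇒representation (map toℕ s) (twoCondition⇒admissible s twoCond))
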